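{- Let $G$ be an $n$-vertex graph forming a map $\mathcal M$ on a surface with (the paper's) Euler characteristic $\chi$, let $T$ be a breadth first search tree of $G$ rooted at $r$, and let $(T,C,X)$ be a tree-cotree decomposition. For integers $0\le i<k$ define $L_{i,k}$, $P_{i,k}(v)$ and $S_{i,k}$ as below. Then for any $k$, $$\sum_{0\le i<k}|S_{i,k}|\le n+(\chi+2)k(k-1).$$
   Context: A map is a connected graph embedded in a closed 2-manifold so that every face is an open disk. A spanning cotree is a set $C$ of edges whose duals form a spanning tree of the dual map; a tree-cotree decomposition is a partition $(T,C,X)$ of the edge set with $T$ a spanning tree and $C$ a spanning cotree. The paper defines $\chi=|X|-2$ (the negative of the usual Euler characteristic; $|X|$ is independent of the decomposition). With $d(v)$ the depth of $v$ in $T$: $L_{i,k}=\{v: d(v)\equiv i \pmod k\}$; for each endpoint $v$ of an edge of $X$, $P_{i,k}(v)\subset T$ is the path connecting $v$ to the first member of $L_{i,k}$ on the path from $v$ to $r$ in $T$; $S_{i,k}$ is the union of $L_{i,k}$ with the vertices of all the paths $P_{i,k}(v)$. -}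

module Defs where

open import Level using (0ℓ)
open import Data.Nat using (ℕ; zero; suc; _≤_; _<_; _%_; _*_; _+_)
open import Data.Nat.Properties using ()
open import Data.Fin using (Fin; toℕ)
open import Data.Empty using (⊥)
open import Data.Fin.Subset using (Subset; _∈_; _∉_; _∪_; _∩_; ∁; ∣_∣; Empty)
open import Data.Product using (Σ; ∃; ∃-syntax; _×_; _,_)
open import Data.Sum using (_⊎_)
open import Data.Integer as ℤ using (ℤ; +_)
open import Relation.Nullary using (¬_)
open import Relation.Binary.PropositionalEquality using (_≡_; _≢_)
open import Function.Bundles using (_⇔_)

data Orbit2 {nf : ℕ} (f g : Fin nf → Fin nf) : Fin nf → Fin nf → Set where
  here  : ∀ {x} → Orbit2 f g x x
  stepf : ∀ {x y} → Orbit2 f g (f x) y → Orbit2 f g x y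
  stepg : ∀ {x y} → Orbit2 f g (g x) y → Orbit2 f g x y

data Orbit3 {nf : ℕ} (f g h : Fin nf → Fin nf) : Fin nf → Fin nf → Set where
  here  : ∀ {x} → Orbit3 f g h x x
  stepf : ∀ {x y} → Orbit3 f g h (f x) y → Orbit3 f g h x y
  stepg : ∀ {x y} → Orbit3 f g h (g x) y → Orbit3 f g h x y
  steph : ∀ {x y} → Orbit3 f g h (h x) y → Orbit3 f g h x y

FixedPointFreeInvolution : {nf : ℕ} → (Fin nf → Fin nf) → Set
FixedPointFreeInvolution {nf} f = (x : Fin nf) → (f (f x) ≡ x) × (f x ≢ x)

Surjective : {a b : ℕ} → (Fin a → Fin b) → Set
Surjective {a} {b} h = (y : Fin b) → ∃[ x ] h x ≡ y

-- A map (connected graph cellularly embedded in a closed surface,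
-- orientable or not), encoded combinatorially as a generalized map
-- (graph-encoded map): a finite set of flags with three fixed-point-free
-- involutions α0 α1 α2 such that α0 α2 is again a fixed-point-free
-- involution and ⟨α0,α1,α2⟩ acts transitively.
-- Vertices = ⟨α1,α2⟩-orbits, edges = ⟨α0,α2⟩-orbits,
-- faces = ⟨α0,α1⟩-orbits; they are labelled by Fin n, Fin m, Fin f
-- through surjections whose fibres are exactly these orbits.

record Map (n : ℕ) : Set where
  field
    nf m f : ℕ
    α0 α1 α2 : Fin nf → Fin nf
    α0-inv : FixedPointFreeInvolution α0
    α1-inv : FixedPointFreeInvolution α1
    α2-inv : FixedPointFreeInvolution α2
    α0α2-inv : FixedPointFreeInvolution (λ x → α0 (α2 x))
    connected : (x y : Fin nf) → Orbit3 α0 α1 α2 x y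
    vtx : Fin nf → Fin n
    edg : Fin nf → Fin m
    fac : Fin nf → Fin f
    vtx-surj : Surjective vtx
    edg-surj : Surjective edg
    fac-surj : Surjective fac
    vtx-orbit : (x y : Fin nf) → (vtx x ≡ vtx y) ⇔ Orbit2 α1 α2 x y
    edg-orbit : (x y : Fin nf) → (edg x ≡ edg y) ⇔ Orbit2 α0 α2 x y
    fac-orbit : (x y : Fin nf) → (fac x ≡ fac y) ⇔ Orbit2 α0 α1 x y

  Joins : Fin m → Fin n → Fin n → Set
  Joins e u w = ∃[ x ] (edg x ≡ e × vtx x ≡ u × vtx (α0 x) ≡ w)

  DualJoins : Fin m → Fin f → Fin f → Set
  DualJoins e u w = ∃[ x ] (edg x ≡ e × fac x ≡ u × fac (α2 x) ≡ w)

module GraphNotions {nv ne : ℕ} (J : Fin ne → Fin nv → Fin nv → Set) where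

  data Walk : Fin nv → Fin nv → ℕ → Set where
    nil  : ∀ {u} → Walk u u 0
    cons : ∀ {e u w z ℓ} → J e u w → Walk w z ℓ → Walk u z (suc ℓ)

  record RootedSpanningTree (r : Fin nv) : Set where
    field
      depth : Fin nv → ℕ
      parent : Fin nv → Fin nv
      parentEdge : Fin nv → Fin ne
      depth-root : depth r ≡ 0
      depth-zero : ∀ v → depth v ≡ 0 → v ≡ r
      parent-depth : ∀ v → v ≢ r → suc (depth (parent v)) ≡ depth v
      parent-joins : ∀ v → v ≢ r → J (parentEdge v) v (parent v)

    TreeEdge : Fin ne → Set
    TreeEdge e = ∃[ v ] (v ≢ r × parentEdge v ≡ e)

    iterParent : ℕ → Fin nv → Fin nv
    iterParent zero v = v
    iterParent (suc j) v = iterParent j (parent v)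

    OnRootPath : Fin nv → Fin nv → Set
    OnRootPath u v = ∃[ j ] (j ≤ depth v × iterParent j v ≡ u)

  -- breadth first search tree: tree depth equals graph distance from r
  IsBFS : {r : Fin nv} → RootedSpanningTree r → Set
  IsBFS {r} R = ∀ v ℓ → Walk r v ℓ → RootedSpanningTree.depth R v ≤ ℓ

  IsSpanningTree : Subset ne → Set
  IsSpanningTree S =
    ∃[ r ] Σ (RootedSpanningTree r) λ R →
      ∀ e → (e ∈ S) ⇔ RootedSpanningTree.TreeEdge R e

module Layers {n : ℕ} (M : Map n) {r : Fin n}
  (R : GraphNotions.RootedSpanningTree (Map.Joins M) r)
  (X : Subset (Map.m M)) where
  open Map M
  open GraphNotions.RootedSpanningTree R

  -- v ∈ L_{i,k}, i.e. d(v) ≡ i (mod k).  (Only used for i < k, so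
  -- k ≥ 1; for k = 0 the layer is taken empty.)
  InLayer : (k i : ℕ) → Fin n → Set
  InLayer zero i v = ⊥
  InLayer (suc k) i v = depth v % suc k ≡ i

  -- u is a vertex of P_{i,k}(v): u is on the tree path from v to r and
  -- no vertex w of that path with d(u) < d(w) (i.e. strictly between u
  -- and v, or v itself) lies in L_{i,k}; so the path runs from v up to
  -- and including the first member of L_{i,k}.  (If the path
  -- to r meets no vertex of L_{i,k}, P_{i,k}(v) is the whole path to r.)
  InP : (k i : ℕ) → Fin n → Fin n → Set
  InP k i v u = OnRootPath u v ×
    (∀ w → OnRootPath w v → depth u < depth w → ¬ InLayer k i w)

  XEndpoint : Fin n → Set
  XEndpoint v = ∃[ e ] (e ∈ X × ∃[ w ] Joins e v w)

  InS : (k i : ℕ) → Fin n → Set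
  InS k i u = InLayer k i u ⊎ ∃[ v ] (XEndpoint v × InP k i v u)

sumFin : (k : ℕ) → (Fin k → ℕ) → ℕ
sumFin zero g = 0
sumFin (suc k) g = g Fin.zero + sumFin k (λ i → g (Fin.suc i))

{-# OPTIONS --safe #-}
-- The tree path from a vertex v towards r enters L_{i,k} after
-- exactly (d(v) − i) mod k steps (unless it reaches r first), so a vertex of
-- S_{i,k} outside L_{i,k} is among the first (d(v) − i) mod k vertices of
-- that path for some endpoint v of an edge of X.  Counting with multiplicity,
-- the layers L_{i,k} (i < k) contribute n in total, and an endpoint v
-- contributes ∑_{i<k} ((d(v) − i) mod k) = 0 + 1 + ⋯ + (k − 1), since
-- i ↦ (d(v) − i) mod k permutes the residues.  Each edge has two endpoints,
-- so X contributes |X| k (k − 1) = (χ + 2) k (k − 1).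
module Submission where

open import Defs
open import Data.Nat using (ℕ)
open import Data.Fin using (Fin; toℕ)
open import Data.Fin.Subset using (Subset; _∈_; _∪_; _∩_; ∁; ∣_∣; Empty)
open import Function.Bundles using (_⇔_)

module Sums where
  open import Data.Nat using (zero; suc; _+_; _*_; _≤_; z≤n)
  open import Data.Nat.Properties hiding (_≟_)
  open import Data.Fin using (_≟_)
  open import Data.Fin.Subset using (inside; outside)
  open import Data.Fin.Subset.Properties using (_∈?_)
  open import Data.Vec using ([]; _∷_)
  open import Data.Vec.Functional using (Vector)
  open import Data.Bool using (if_then_else_)
  open import Algebra.Properties.Semiring.Sum +-*-semiring public
    using (sum; sum-syntax; sum-cong-≗; ∑-comm; ∑-distrib-+; *-distribˡ-sum; *-distribʳ-sum)
  open import Algebra.Properties.Semiring.Sum +-*-semiring using (sum-remove; sum-replicate-zero)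
  open import Function using (_∘_)
  open import Relation.Nullary using (Dec; does; yes; no)
  open import Relation.Nullary.Decidable using (dec-true)
  open import Relation.Binary.PropositionalEquality

  𝟙[_] : ∀ {p} {P : Set p} → Dec P → ℕ
  𝟙[ P? ] = if does P? then 1 else 0

  𝟙[]≡1 : ∀ {p} {P : Set p} (P? : Dec P) → P → 𝟙[ P? ] ≡ 1
  𝟙[]≡1 P? x rewrite dec-true P? x = refl

  𝟙[]≤ : ∀ {p} {P : Set p} (P? : Dec P) {m} → (P → 1 ≤ m) → 𝟙[ P? ] ≤ m
  𝟙[]≤ (yes x) 1≤m = 1≤m x
  𝟙[]≤ (no _)  _   = z≤n

  sumFin≡sum : ∀ k (f : Vector ℕ k) → sumFin k f ≡ sum f
  sumFin≡sum zero    f = refl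
  sumFin≡sum (suc k) f = cong (f Fin.zero +_) (sumFin≡sum k (f ∘ Fin.suc))

  sum-mono-≤ : ∀ {k} {f g : Vector ℕ k} → (∀ i → f i ≤ g i) → sum f ≤ sum g
  sum-mono-≤ {zero}  f≤g = z≤n
  sum-mono-≤ {suc k} f≤g = +-mono-≤ (f≤g Fin.zero) (sum-mono-≤ (f≤g ∘ Fin.suc))

  f≤sum : ∀ {k} (f : Vector ℕ k) i → f i ≤ sum f
  f≤sum {suc k} f i = ≤-trans (m≤m+n (f i) _) (≤-reflexive (sym (sum-remove {i = i} f)))

  ∑-1 : ∀ n → ∑[ i < n ] 1 ≡ n
  ∑-1 zero    = refl
  ∑-1 (suc n) = cong suc (∑-1 n)

  ∑-𝟙[≟] : ∀ {n} (c : Fin n) → ∑[ i < n ] 𝟙[ c ≟ i ] ≡ 1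
  ∑-𝟙[≟] {suc n} Fin.zero    = cong suc (sum-replicate-zero n)
  ∑-𝟙[≟] {suc n} (Fin.suc c) = ∑-𝟙[≟] c

  ∑-comm-*ˡ : ∀ {m n} (w : Vector ℕ m) (f : Fin m → Fin n → ℕ) →
              ∑[ j < n ] ∑[ e < m ] (w e * f e j) ≡ ∑[ e < m ] (w e * ∑[ j < n ] f e j)
  ∑-comm-*ˡ w f = trans (∑-comm (λ j e → w e * f e j))
                        (sum-cong-≗ (λ e → sym (*-distribˡ-sum (w e) (f e))))

  ∣p∣≡∑𝟙[∈] : ∀ {n} (p : Subset n) → ∣ p ∣ ≡ ∑[ u < n ] 𝟙[ u ∈? p ]
  ∣p∣≡∑𝟙[∈] []            = refl
  ∣p∣≡∑𝟙[∈] (inside  ∷ p) = cong suc (∣p∣≡∑𝟙[∈] p)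
  ∣p∣≡∑𝟙[∈] (outside ∷ p) = ∣p∣≡∑𝟙[∈] p

  fibreSize : ∀ {t n} → (Fin t → Fin n) → Fin n → ℕ
  fibreSize {t} g u = ∑[ j < t ] 𝟙[ g j ≟ u ]

  ∑-fibreSize : ∀ {t n} (g : Fin t → Fin n) → ∑[ u < n ] fibreSize g u ≡ t
  ∑-fibreSize {t} g = begin
    ∑[ u < _ ] ∑[ j < t ] 𝟙[ g j ≟ u ]  ≡⟨ ∑-comm (λ u j → 𝟙[ g j ≟ u ]) ⟩
    ∑[ j < t ] ∑[ u < _ ] 𝟙[ g j ≟ u ]  ≡⟨ sum-cong-≗ (∑-𝟙[≟] ∘ g) ⟩
    ∑[ j < t ] 1                        ≡⟨ ∑-1 t ⟩
    t                                   ∎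
    where open ≡-Reasoning

  1≤fibreSize : ∀ {t n} (g : Fin t → Fin n) j → 1 ≤ fibreSize g (g j)
  1≤fibreSize g j = ≤-trans (≤-reflexive (sym (𝟙[]≡1 (g j ≟ g j) refl)))
                            (f≤sum (λ j′ → 𝟙[ g j′ ≟ g j ]) j)

module Residues where
  open import Data.Nat using (zero; suc; _+_; _*_; _∸_; _%_; _≤_; _<_; s≤s; NonZero)
  open import Data.Nat.Properties
  open import Data.Nat.DivMod using (_/_; m≡m%n+[m/n]*n; [m+n]%n≡m%n; [m+kn]%n≡m%n; m<n⇒m%n≡m; n%n≡0)
  open import Data.Fin using (fromℕ; inject₁)
  open import Data.Fin.Properties using (toℕ-fromℕ; toℕ-inject₁; toℕ<n)
  open import Algebra.Properties.CommutativeSemigroup +-commutativeSemigroup using (interchange)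
  open import Algebra.Properties.Semiring.Sum +-*-semiring using (sum-init-last)
  open import Function using (_∘_)
  open import Relation.Binary.PropositionalEquality
  open Sums

  -- (d − i) mod k for i < k, kept free of truncated subtraction by adding k.
  stepsToLayer : (k : ℕ) .{{_ : NonZero k}} → ℕ → ℕ → ℕ
  stepsToLayer k d i = (d + (k ∸ i)) % k

  stepsToLayer-lands : ∀ k .{{_ : NonZero k}} d {i} → i < k → stepsToLayer k d i ≤ d →
                       (d ∸ stepsToLayer k d i) % k ≡ i
  stepsToLayer-lands k d {i} i<k t≤d = begin
    (d ∸ t) % k      ≡⟨ [m+n]%n≡m%n (d ∸ t) k ⟨
    (d ∸ t + k) % k  ≡⟨ cong (_% k) d∸t+k≡i+qk ⟩
    (i + q * k) % k  ≡⟨ [m+kn]%n≡m%n i q k ⟩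
    i % k            ≡⟨ m<n⇒m%n≡m i<k ⟩
    i                ∎
    where
    open ≡-Reasoning
    a t q : ℕ
    a = d + (k ∸ i)
    t = a % k
    q = a / k
    d∸t+k≡i+qk : d ∸ t + k ≡ i + q * k
    d∸t+k≡i+qk = begin
      d ∸ t + k              ≡⟨ cong (d ∸ t +_) (m∸n+n≡m (<⇒≤ i<k)) ⟨
      d ∸ t + (k ∸ i + i)    ≡⟨ +-assoc (d ∸ t) (k ∸ i) i ⟨
      d ∸ t + (k ∸ i) + i    ≡⟨ cong (_+ i) (+-∸-comm (k ∸ i) t≤d) ⟨
      a ∸ t + i              ≡⟨ cong (λ a′ → a′ ∸ t + i) (m≡m%n+[m/n]*n a k) ⟩
      t + q * k ∸ t + i      ≡⟨ cong (_+ i) (m+n∸m≡n t (q * k)) ⟩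
      q * k + i              ≡⟨ +-comm (q * k) i ⟩
      i + q * k              ∎

  -- Raising d by one rotates the summands: the new i = 0 term is the old i = k − 1 term.
  ∑-stepsToLayer-suc : ∀ k .{{_ : NonZero k}} d →
    ∑[ i < k ] stepsToLayer k (suc d) (toℕ i) ≡ ∑[ i < k ] stepsToLayer k d (toℕ i)
  ∑-stepsToLayer-suc (suc K) d = begin
    f (suc d) 0 + ∑[ i < K ] f (suc d) (suc (toℕ i))        ≡⟨ cong₂ _+_ wrap (sum-cong-≗ shift) ⟩
    f d K + ∑[ i < K ] f d (toℕ (inject₁ i))                ≡⟨ +-comm (f d K) _ ⟩
    ∑[ i < K ] f d (toℕ (inject₁ i)) + f d K                ≡⟨ cong (λ x → ∑[ i < K ] f d (toℕ (inject₁ i)) + f d x) (toℕ-fromℕ K) ⟨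
    ∑[ i < K ] f d (toℕ (inject₁ i)) + f d (toℕ (fromℕ K))  ≡⟨ sum-init-last {K} (f d ∘ toℕ) ⟨
    ∑[ i < suc K ] f d (toℕ i)                              ∎
    where
    open ≡-Reasoning
    f : ℕ → ℕ → ℕ
    f = stepsToLayer (suc K)
    wrap : f (suc d) 0 ≡ f d K
    wrap = begin
      (suc d + suc K) % suc K  ≡⟨ [m+n]%n≡m%n (suc d) (suc K) ⟩
      suc d % suc K            ≡⟨ cong (_% suc K) (trans (+-comm 1 d) (cong (d +_) (sym (m+n∸n≡m 1 K)))) ⟩
      (d + (suc K ∸ K)) % suc K ∎
    shift : ∀ (i : Fin K) → f (suc d) (suc (toℕ i)) ≡ f d (toℕ (inject₁ i))
    shift i = cong (_% suc K) (begin
      suc d + (K ∸ toℕ i)               ≡⟨ +-suc d (K ∸ toℕ i) ⟨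
      d + suc (K ∸ toℕ i)               ≡⟨ cong (d +_) (+-∸-assoc 1 (<⇒≤ (toℕ<n i))) ⟨
      d + (suc K ∸ toℕ i)               ≡⟨ cong (λ j → d + (suc K ∸ j)) (toℕ-inject₁ i) ⟨
      d + (suc K ∸ toℕ (inject₁ i))     ∎)

  ∑-stepsToLayer : ∀ K d → ∑[ i < suc K ] stepsToLayer (suc K) d (toℕ i) ≡ ∑[ j < K ] (K ∸ toℕ j)
  ∑-stepsToLayer K zero    = cong₂ _+_ (n%n≡0 (suc K))
                                   (sum-cong-≗ {K} (λ j → m<n⇒m%n≡m (s≤s (m∸n≤m K (toℕ j)))))
  ∑-stepsToLayer K (suc d) = trans (∑-stepsToLayer-suc (suc K) d) (∑-stepsToLayer K d)

  ∑-reverse-double : ∀ K → ∑[ j < K ] (K ∸ toℕ j) + ∑[ j < K ] (K ∸ toℕ j) ≡ suc K * K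
  ∑-reverse-double zero    = refl
  ∑-reverse-double (suc K) = begin
    (suc K + G) + (suc K + G)    ≡⟨ interchange (suc K) G (suc K) G ⟩
    (suc K + suc K) + (G + G)    ≡⟨ cong (suc K + suc K +_) (∑-reverse-double K) ⟩
    (suc K + suc K) + suc K * K  ≡⟨ +-assoc (suc K) (suc K) (suc K * K) ⟩
    suc K + (suc K + suc K * K)  ≡⟨ cong (λ x → suc K + (suc K + x)) (*-comm (suc K) K) ⟩
    suc (suc K) * suc K          ∎
    where
    open ≡-Reasoning
    G : ℕ
    G = ∑[ j < K ] (K ∸ toℕ j)

module Endpoints {n : ℕ} (M : Map n) where
  open import Data.Product using (_×_; _,_; proj₁; proj₂)
  open import Data.Sum using (_⊎_; inj₁; inj₂)
  open import Function using (_∘_)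
  open import Function.Bundles using (Equivalence)
  open import Relation.Binary.PropositionalEquality
  open Map M

  α0α2≡α2α0 : ∀ x → α0 (α2 x) ≡ α2 (α0 x)
  α0α2≡α2α0 x = begin
    α0 (α2 x)                      ≡⟨ proj₁ (α2-inv (α0 (α2 x))) ⟨
    α2 (α2 (α0 (α2 x)))            ≡⟨ cong α2 (proj₁ (α0-inv (α2 (α0 (α2 x))))) ⟨
    α2 (α0 (α0 (α2 (α0 (α2 x)))))  ≡⟨ cong (α2 ∘ α0) (proj₁ (α0α2-inv x)) ⟩
    α2 (α0 x)                      ∎
    where
    open ≡-Reasoning

  vtx∘α2 : ∀ x → vtx (α2 x) ≡ vtx x
  vtx∘α2 x = sym (Equivalence.from (vtx-orbit x (α2 x)) (Orbit2.stepg Orbit2.here))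

  end₁ end₂ : Fin m → Fin n
  end₁ e = vtx (proj₁ (edg-surj e))
  end₂ e = vtx (α0 (proj₁ (edg-surj e)))

  OneOf : Fin n → Fin n → Fin n → Set
  OneOf a b v = v ≡ a ⊎ v ≡ b

  EndsAmong : Fin n → Fin n → Fin nf → Set
  EndsAmong a b x = OneOf a b (vtx x) × OneOf a b (vtx (α0 x))

  -- α0 swaps the two ends of a flag's edge and α2 (commuting with α0) fixes both.
  EndsAmong-orbit : ∀ {a b x y} → Orbit2 α0 α2 x y → EndsAmong a b x → EndsAmong a b y
  EndsAmong-orbit Orbit2.here ends = ends
  EndsAmong-orbit {a} {b} {x} (Orbit2.stepf o) (ends₁ , ends₂) =
    EndsAmong-orbit o (ends₂ , subst (OneOf a b ∘ vtx) (sym (proj₁ (α0-inv x))) ends₁)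
  EndsAmong-orbit {a} {b} {x} (Orbit2.stepg o) (ends₁ , ends₂) =
    EndsAmong-orbit o (subst (OneOf a b) (sym (vtx∘α2 x)) ends₁ ,
                       subst (OneOf a b) (sym (trans (cong vtx (α0α2≡α2α0 x)) (vtx∘α2 (α0 x)))) ends₂)

  Joins⇒end : ∀ {e v w} → Joins e v w → OneOf (end₁ e) (end₂ e) v
  Joins⇒end {e} (x , edg-x≡e , vtx-x≡v , _) =
    subst (OneOf (end₁ e) (end₂ e)) vtx-x≡v (proj₁ (EndsAmong-orbit rep~x (inj₁ refl , inj₂ refl)))
    where
    rep~x : Orbit2 α0 α2 (proj₁ (edg-surj e)) x
    rep~x = Equivalence.to (edg-orbit _ x) (trans (proj₂ (edg-surj e)) (sym edg-x≡e))

module RootPaths {nv ne : ℕ} {J : Fin ne → Fin nv → Fin nv → Set} {r : Fin nv}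
                 (R : GraphNotions.RootedSpanningTree J r) where
  open import Data.Nat using (zero; suc; _+_; _≤_; s≤s⁻¹)
  open import Data.Nat.Properties using (+-identityʳ; +-suc)
  open import Relation.Binary.PropositionalEquality
  open GraphNotions.RootedSpanningTree R

  depth-iterParent : ∀ j v → j ≤ depth v → depth (iterParent j v) + j ≡ depth v
  depth-iterParent zero    v _      = +-identityʳ (depth v)
  depth-iterParent (suc j) v 1+j≤dv = begin
    depth (iterParent j (parent v)) + suc j    ≡⟨ +-suc _ j ⟩
    suc (depth (iterParent j (parent v)) + j)  ≡⟨ cong suc (depth-iterParent j (parent v) j≤dp) ⟩
    suc (depth (parent v))                     ≡⟨ parent-depth v v≢r ⟩
    depth v                                    ∎
    where
    open ≡-Reasoning
    v≢r : v ≢ r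
    v≢r refl with () ← subst (suc j ≤_) depth-root 1+j≤dv
    j≤dp : j ≤ depth (parent v)
    j≤dp = s≤s⁻¹ (subst (suc j ≤_) (sym (parent-depth v v≢r)) 1+j≤dv)

module Charging {n : ℕ} (M : Map n) {r : Fin n}
                (R : GraphNotions.RootedSpanningTree (Map.Joins M) r) (X : Subset (Map.m M)) where
  open import Data.Nat using (zero; suc; _+_; _*_; _∸_; _%_; _≤_; _<_; z≤n; s≤s)
  open import Data.Nat.Properties hiding (_≟_)
  open import Data.Nat.DivMod using (_mod_)
  open import Data.Fin using (fromℕ<; _≟_)
  open import Data.Fin.Properties using (toℕ-injective; toℕ-fromℕ<; toℕ<n)
  open import Data.Fin.Subset.Properties using (_∈?_)
  open import Data.Product using (∃; _,_)
  open import Data.Sum using (inj₁; inj₂; [_,_]′)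
  open import Data.Empty using (⊥-elim)
  open import Function using (_∘_)
  open import Function.Bundles using (Equivalence)
  open import Relation.Nullary using (yes; no; ¬_)
  open import Relation.Binary.PropositionalEquality
  open Map M using (m; Joins)
  open GraphNotions.RootedSpanningTree R
  open Layers M R X
  open Sums
  open Residues
  open Endpoints M
  open RootPaths R

  module _ (K : ℕ) where
    k : ℕ
    k = suc K

    layer : Fin n → Fin k
    layer u = depth u mod k

    InLayer⇒layer≡ : ∀ {i u} → InLayer k (toℕ i) u → layer u ≡ i
    InLayer⇒layer≡ d%k≡i = toℕ-injective (trans (toℕ-fromℕ< _) d%k≡i)

    steps : Fin k → Fin n → ℕ
    steps i v = stepsToLayer k (depth v) (toℕ i)

    climb : (i : Fin k) (v : Fin n) → Fin (steps i v) → Fin n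
    climb i v j = iterParent (toℕ j) v

    iterParent-steps∈L : ∀ i v → steps i v ≤ depth v → InLayer k (toℕ i) (iterParent (steps i v) v)
    iterParent-steps∈L i v t≤dv = begin
      depth w % k            ≡⟨ cong (_% k) (m+n∸n≡m (depth w) t) ⟨
      (depth w + t ∸ t) % k  ≡⟨ cong (λ d → (d ∸ t) % k) (depth-iterParent t v t≤dv) ⟩
      (depth v ∸ t) % k      ≡⟨ stepsToLayer-lands k (depth v) (toℕ<n i) t≤dv ⟩
      toℕ i                  ∎
      where
      open ≡-Reasoning
      t : ℕ
      t = steps i v
      w : Fin n
      w = iterParent t v

    InP⇒climb : ∀ {i v u} → InP k (toℕ i) v u → ¬ InLayer k (toℕ i) u → ∃ λ j → climb i v j ≡ u
    InP⇒climb {i} {v} ((j , j≤dv , refl) , noLayerAbove) u∉L with j <? steps i v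
    ... | yes j<t = fromℕ< j<t , cong (λ j′ → iterParent j′ v) (toℕ-fromℕ< j<t)
    ... | no  j≮t = ⊥-elim ([ ¬du<dw , u∉L ∘ du≡dw⇒u∈L ]′ (m≤n⇒m<n∨m≡n du≤dw))
      where
      t : ℕ
      t = steps i v
      t≤j : t ≤ j
      t≤j = ≮⇒≥ j≮t
      t≤dv : t ≤ depth v
      t≤dv = ≤-trans t≤j j≤dv
      w : Fin n
      w = iterParent t v
      du≤dw : depth (iterParent j v) ≤ depth w
      du≤dw = +-cancelʳ-≤ j _ _ (begin
        depth (iterParent j v) + j  ≡⟨ depth-iterParent j v j≤dv ⟩
        depth v                     ≡⟨ depth-iterParent t v t≤dv ⟨
        depth w + t                 ≤⟨ +-monoʳ-≤ (depth w) t≤j ⟩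
        depth w + j                 ∎)
        where open ≤-Reasoning
      ¬du<dw : ¬ depth (iterParent j v) < depth w
      ¬du<dw du<dw = noLayerAbove w (t , t≤dv , refl) du<dw (iterParent-steps∈L i v t≤dv)
      du≡dw⇒u∈L : depth (iterParent j v) ≡ depth w → InLayer k (toℕ i) (iterParent j v)
      du≡dw⇒u∈L du≡dw = trans (cong (_% k) du≡dw) (iterParent-steps∈L i v t≤dv)

    endLoad : Fin k → Fin m → Fin n → ℕ
    endLoad i e u = fibreSize (climb i (end₁ e)) u + fibreSize (climb i (end₂ e)) u

    load : Fin k → Fin n → ℕ
    load i u = ∑[ e < m ] (𝟙[ e ∈? X ] * endLoad i e u)

    1≤endLoad : ∀ {i e v w u} → Joins e v w → 1 ≤ fibreSize (climb i v) u → 1 ≤ endLoad i e u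
    1≤endLoad e:vw 1≤F with Joins⇒end e:vw
    ... | inj₁ refl = ≤-trans 1≤F (m≤m+n _ _)
    ... | inj₂ refl = ≤-trans 1≤F (m≤n+m _ _)

    1≤charge : ∀ {i u} → InS k (toℕ i) u → 1 ≤ 𝟙[ layer u ≟ i ] + load i u
    1≤charge {i} {u} u∈S with layer u ≟ i | u∈S
    ... | yes _   | _         = s≤s z≤n
    ... | no  u∉L | inj₁ u∈L  = ⊥-elim (u∉L (InLayer⇒layer≡ u∈L))
    ... | no  u∉L | inj₂ (v , (e , e∈X , w , e:vw) , u∈P) with InP⇒climb u∈P (u∉L ∘ InLayer⇒layer≡)
    ...   | j , refl = ≤-trans (≤-trans 1≤term (f≤sum _ e)) (m≤n+m _ _)
      where
      1≤term : 1 ≤ 𝟙[ e ∈? X ] * endLoad i e u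
      1≤term = begin
        1                            ≤⟨ 1≤endLoad {i} e:vw (1≤fibreSize (climb i v) j) ⟩
        endLoad i e u                ≡⟨ *-identityˡ (endLoad i e u) ⟨
        1 * endLoad i e u            ≡⟨ cong (_* endLoad i e u) (𝟙[]≡1 (e ∈? X) e∈X) ⟨
        𝟙[ e ∈? X ] * endLoad i e u  ∎
        where open ≤-Reasoning

    ∑-layer : ∑[ i < k ] ∑[ u < n ] 𝟙[ layer u ≟ i ] ≡ n
    ∑-layer = trans (∑-comm (λ i u → 𝟙[ layer u ≟ i ]))
                    (trans (sum-cong-≗ (∑-𝟙[≟] ∘ layer)) (∑-1 n))

    ∑-endLoad : ∀ e → ∑[ i < k ] ∑[ u < n ] endLoad i e u ≡ k * K
    ∑-endLoad e = begin
      ∑[ i < k ] ∑[ u < n ] endLoad i e u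
        ≡⟨ sum-cong-≗ (λ i → ∑-distrib-+ (climbFibre i end₁) (climbFibre i end₂)) ⟩
      ∑[ i < k ] (∑[ u < n ] climbFibre i end₁ u + ∑[ u < n ] climbFibre i end₂ u)
        ≡⟨ sum-cong-≗ (λ i → cong₂ _+_ (∑-fibreSize (climb i (end₁ e))) (∑-fibreSize (climb i (end₂ e)))) ⟩
      ∑[ i < k ] (steps i (end₁ e) + steps i (end₂ e))
        ≡⟨ ∑-distrib-+ (λ i → steps i (end₁ e)) (λ i → steps i (end₂ e)) ⟩
      ∑[ i < k ] steps i (end₁ e) + ∑[ i < k ] steps i (end₂ e)
        ≡⟨ cong₂ _+_ (∑-stepsToLayer K (depth (end₁ e))) (∑-stepsToLayer K (depth (end₂ e))) ⟩
      ∑[ j < K ] (K ∸ toℕ j) + ∑[ j < K ] (K ∸ toℕ j)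
        ≡⟨ ∑-reverse-double K ⟩
      k * K
        ∎
      where
      open ≡-Reasoning
      climbFibre : Fin k → (Fin m → Fin n) → Fin n → ℕ
      climbFibre i end = fibreSize (climb i (end e))

    ∑-load : ∑[ i < k ] ∑[ u < n ] load i u ≡ ∣ X ∣ * (k * K)
    ∑-load = begin
      ∑[ i < k ] ∑[ u < n ] ∑[ e < m ] (𝟙[ e ∈? X ] * endLoad i e u)
        ≡⟨ sum-cong-≗ (λ i → ∑-comm-*ˡ (λ e → 𝟙[ e ∈? X ]) (endLoad i)) ⟩
      ∑[ i < k ] ∑[ e < m ] (𝟙[ e ∈? X ] * ∑[ u < n ] endLoad i e u)
        ≡⟨ ∑-comm-*ˡ (λ e → 𝟙[ e ∈? X ]) (λ e i → ∑[ u < n ] endLoad i e u) ⟩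
      ∑[ e < m ] (𝟙[ e ∈? X ] * ∑[ i < k ] ∑[ u < n ] endLoad i e u)
        ≡⟨ sum-cong-≗ (λ e → cong (𝟙[ e ∈? X ] *_) (∑-endLoad e)) ⟩
      ∑[ e < m ] (𝟙[ e ∈? X ] * (k * K))
        ≡⟨ *-distribʳ-sum (k * K) (λ e → 𝟙[ e ∈? X ]) ⟨
      ∑[ e < m ] 𝟙[ e ∈? X ] * (k * K)
        ≡⟨ cong (_* (k * K)) (∣p∣≡∑𝟙[∈] X) ⟨
      ∣ X ∣ * (k * K)
        ∎
      where open ≡-Reasoning

    ∑∣S∣≤ : (s : Fin k → Subset n) → (∀ i u → (u ∈ s i) ⇔ InS k (toℕ i) u) →
            ∑[ i < k ] ∣ s i ∣ ≤ n + ∣ X ∣ * (k * K)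
    ∑∣S∣≤ s s≡S = begin
      ∑[ i < k ] ∣ s i ∣
        ≡⟨ sum-cong-≗ (∣p∣≡∑𝟙[∈] ∘ s) ⟩
      ∑[ i < k ] ∑[ u < n ] 𝟙[ u ∈? s i ]
        ≤⟨ sum-mono-≤ (λ i → sum-mono-≤ (λ u → 𝟙[]≤ (u ∈? s i) (1≤charge ∘ Equivalence.to (s≡S i u)))) ⟩
      ∑[ i < k ] ∑[ u < n ] (𝟙[ layer u ≟ i ] + load i u)
        ≡⟨ sum-cong-≗ (λ i → ∑-distrib-+ (λ u → 𝟙[ layer u ≟ i ]) (load i)) ⟩
      ∑[ i < k ] (∑[ u < n ] 𝟙[ layer u ≟ i ] + ∑[ u < n ] load i u)
        ≡⟨ ∑-distrib-+ (λ i → ∑[ u < n ] 𝟙[ layer u ≟ i ]) (λ i → ∑[ u < n ] load i u) ⟩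
      ∑[ i < k ] ∑[ u < n ] 𝟙[ layer u ≟ i ] + ∑[ i < k ] ∑[ u < n ] load i u
        ≡⟨ cong₂ _+_ ∑-layer ∑-load ⟩
      n + ∣ X ∣ * (k * K)
        ∎
      where open ≤-Reasoning

  sumFin∣S∣≤ : ∀ k (s : Fin k → Subset n) → (∀ i u → (u ∈ s i) ⇔ InS k (toℕ i) u) →
               sumFin k (λ i → ∣ s i ∣) ≤ n + ∣ X ∣ * k * (k ∸ 1)
  sumFin∣S∣≤ zero    s s≡S = z≤n
  sumFin∣S∣≤ (suc K) s s≡S = begin
    sumFin (suc K) (λ i → ∣ s i ∣)  ≡⟨ sumFin≡sum (suc K) (λ i → ∣ s i ∣) ⟩
    ∑[ i < suc K ] ∣ s i ∣          ≤⟨ ∑∣S∣≤ K s s≡S ⟩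
    n + ∣ X ∣ * (suc K * K)         ≡⟨ cong (n +_) (*-assoc ∣ X ∣ (suc K) K) ⟨
    n + ∣ X ∣ * suc K * K           ∎
    where open ≤-Reasoning

open import Data.Integer using (ℤ; +_; _+_; _-_; _*_; _≤_; +≤+)
open import Data.Integer.Properties using (+-0-abelianGroup; pos-*)
open import Algebra.Properties.AbelianGroup +-0-abelianGroup using (//-rightDividesˡ)
import Data.Nat as ℕ
import Data.Nat.Properties as ℕ
open import Relation.Binary.PropositionalEquality

-- At k = 0 the integer k − 1 is −1 while k ∸ 1 = 0; the factor c * k = 0 absorbs the difference.
pos-*-minus-one : ∀ c k → + (c ℕ.* k) * (+ k - + 1) ≡ + (c ℕ.* k ℕ.* (k ℕ.∸ 1))
pos-*-minus-one c ℕ.zero    rewrite ℕ.*-zeroʳ c = refl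
pos-*-minus-one c (ℕ.suc K) = sym (pos-* (c ℕ.* ℕ.suc K) K)

rhs≡pos : ∀ n x k → + n + (+ x - + 2 + + 2) * + k * (+ k - + 1) ≡ + (n ℕ.+ x ℕ.* k ℕ.* (k ℕ.∸ 1))
rhs≡pos n x k = cong (λ y → + n + y) (begin
  (+ x - + 2 + + 2) * + k * (+ k - + 1)  ≡⟨ cong (λ y → y * + k * (+ k - + 1)) (//-rightDividesˡ (+ 2) (+ x)) ⟩
  + x * + k * (+ k - + 1)                ≡⟨ cong (_* (+ k - + 1)) (pos-* x k) ⟨
  + (x ℕ.* k) * (+ k - + 1)              ≡⟨ pos-*-minus-one x k ⟩
  + (x ℕ.* k ℕ.* (k ℕ.∸ 1))              ∎)
  where open ≡-Reasoning

lemma9 : ∀ {n} (M : Map n) (r : Fin n)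
    (R : GraphNotions.RootedSpanningTree (Map.Joins M) r) →
    GraphNotions.IsBFS (Map.Joins M) R →
    (T C : Subset (Map.m M)) →
    (∀ e → (e ∈ T) ⇔ GraphNotions.RootedSpanningTree.TreeEdge R e) →
    GraphNotions.IsSpanningTree (Map.DualJoins M) C →
    Empty (T ∩ C) →
    let X = ∁ (T ∪ C)
        χ = + ∣ X ∣ - + 2
    in (k : ℕ) → (s : Fin k → Subset n) →
       (∀ i v → (v ∈ s i) ⇔ Layers.InS M R X k (toℕ i) v) →
       + sumFin k (λ i → ∣ s i ∣) ≤ + n + (χ + + 2) * + k * (+ k - + 1)
lemma9 {n} M r R _ T C _ _ _ k s s≡S =
  subst (+ sumFin k (λ i → ∣ s i ∣) ≤_) (sym (rhs≡pos n ∣ ∁ (T ∪ C) ∣ k))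
        (+≤+ (Charging.sumFin∣S∣≤ M R (∁ (T ∪ C)) k s s≡S))
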